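{- Let $p$ be a prime, $e \ge 1$ and $k \ge 1$ integers. Then $\operatorname{lcm}(1,2,\ldots,k)$ divides $\pi_{p^e}(k)$.
   Context: $p_{\le k}(n)$ denotes the number of partitions of $n$ with at most $k$ parts; its generating function is $\prod_{i=1}^k (1-q^i)^{ -1}$. The sequence $(p_{\le k}(n) \bmod M)_{n\ge 0}$ is purely periodic for every modulus $M\in\mathbb{N}$, and $\pi_M(k)$ denotes its minimal period. -}

module Defs where

open import Data.Nat using (ℕ; zero; suc; _+_; _*_; _∸_; _%_; _≤_; _/_; NonZero)
open import Data.Nat.LCM using (lcm)
open import Data.Product using (_×_)
open import Relation.Binary.PropositionalEquality using (_≡_)

sumTo : ℕ → (ℕ → ℕ) → ℕ
sumTo zero    f = f 0
sumTo (suc m) f = sumTo m f + f (suc m)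

-- partitionsAtMost k n = p_{≤k}(n): number of partitions of n with at most k parts
-- (equivalently, by conjugation, with all parts ≤ k); it is the coefficient of q^n in
-- ∏_{i=1}^k (1-q^i)^{-1}.  Recursion: choose the multiplicity j of the part k+1.
partitionsAtMost : ℕ → ℕ → ℕ
partitionsAtMost zero    zero    = 1
partitionsAtMost zero    (suc n) = 0
partitionsAtMost (suc k) n = sumTo (n / suc k) (λ j → partitionsAtMost k (n ∸ j * suc k))

IsPeriod : (M : ℕ) → .{{NonZero M}} → ℕ → ℕ → Set
IsPeriod M k t = (1 ≤ t) × (∀ n → partitionsAtMost k (n + t) % M ≡ partitionsAtMost k n % M)

IsMinimalPeriod : (M : ℕ) → .{{NonZero M}} → ℕ → ℕ → Set
IsMinimalPeriod M k t = IsPeriod M k t × (∀ s → IsPeriod M k s → t ≤ s)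

lcmUpTo : ℕ → ℕ
lcmUpTo zero    = 1
lcmUpTo (suc k) = lcm (lcmUpTo k) (suc k)

-- Write W_c g for g(q)/(1 − q^c); the generating function of p_{≤k} is W_k ⋯ W_1 applied to δ₀.
-- If W_c g is eventually periodic modulo M with period π then so is g, because
-- g(n) = W_c g(n) − W_c g(n − c) for n ≥ c. The W_c commute, so all factors other than W_c can
-- be stripped off, leaving W_c δ₀, the indicator function of cℕ, which is eventually periodic
-- modulo M > 1 with period π only if c ∣ π.
module Submission where

open import Defs
open import Data.Nat using (ℕ; _^_; _≤_; NonZero)
open import Data.Nat.Divisibility using (_∣_)
open import Data.Nat.Primality using (Prime; prime⇒nonTrivial)

open import Data.Nat using (zero; suc; _+_; _*_; _∸_; _%_; _/_; _<_; z<s; s≤s; _<?_; nonTrivial⇒n>1; >-nonZero⁻¹)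
open import Data.Nat.Divisibility using (1∣_; m%n≡0⇒n∣m)
open import Data.Nat.LCM using (lcm-least)
open import Data.Nat.Tactic.RingSolver using (solve-∀)
open import Data.Nat.Properties
open import Algebra.Properties.CommutativeSemigroup +-commutativeSemigroup using (interchange)
open import Data.Nat.DivMod
open import Data.Nat.Induction using (<-rec)
open import Data.Product using (∃-syntax; _,_)
open import Data.Sum using (inj₁; inj₂)
open import Relation.Nullary using (yes; no; contradiction)
open import Relation.Binary.PropositionalEquality
open ≡-Reasoning

sumTo-cong : ∀ m {f g : ℕ → ℕ} → (∀ t → f t ≡ g t) → sumTo m f ≡ sumTo m g
sumTo-cong zero    f≗g = f≗g 0
sumTo-cong (suc m) f≗g = cong₂ _+_ (sumTo-cong m f≗g) (f≗g (suc m))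

sumTo-suc : ∀ m (f : ℕ → ℕ) → sumTo (suc m) f ≡ f 0 + sumTo m (λ t → f (suc t))
sumTo-suc zero    f = refl
sumTo-suc (suc m) f = begin
  sumTo (suc m) f + f (suc (suc m))                          ≡⟨ cong (_+ f (suc (suc m))) (sumTo-suc m f) ⟩
  f 0 + sumTo m (λ t → f (suc t)) + f (suc (suc m))          ≡⟨ +-assoc (f 0) _ _ ⟩
  f 0 + (sumTo m (λ t → f (suc t)) + f (suc (suc m)))        ∎

-- Coefficients of g(q)/(1 − q^c): the partitions counted by g, with parts of size c added.
withPart : (c : ℕ) .{{_ : NonZero c}} → (ℕ → ℕ) → ℕ → ℕ
withPart c g n = sumTo (n / c) (λ t → g (n ∸ t * c))

module _ (c : ℕ) .{{_ : NonZero c}} (g : ℕ → ℕ) where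

  withPart-< : ∀ {n} → n < c → withPart c g n ≡ g n
  withPart-< n<c rewrite m<n⇒m/n≡0 n<c = refl

  withPart-+ : ∀ m → withPart c g (c + m) ≡ g (c + m) + withPart c g m
  withPart-+ m = begin
    sumTo ((c + m) / c) h                         ≡⟨ cong (λ z → sumTo z h) [c+m]/c≡1+m/c ⟩
    sumTo (suc (m / c)) h                         ≡⟨ sumTo-suc (m / c) h ⟩
    h 0 + sumTo (m / c) (λ t → h (suc t))         ≡⟨ cong (h 0 +_) (sumTo-cong (m / c) λ t → cong g ([m+n]∸[m+o]≡n∸o c m (t * c))) ⟩
    g (c + m) + withPart c g m                    ∎
    where
    h : ℕ → ℕ
    h t = g (c + m ∸ t * c)
    [c+m]/c≡1+m/c : (c + m) / c ≡ suc (m / c)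
    [c+m]/c≡1+m/c = trans (m/n≡1+[m∸n]/n (m≤m+n c m)) (cong (λ z → suc (z / c)) (m+n∸m≡n c m))

-- Coefficients of q^c · f(q).
shift : ℕ → (ℕ → ℕ) → ℕ → ℕ
shift zero    f n       = f n
shift (suc c) f zero    = 0
shift (suc c) f (suc n) = shift c f n

shift-< : ∀ c f {n} → n < c → shift c f n ≡ 0
shift-< (suc c) f {zero}  _         = refl
shift-< (suc c) f {suc n} (s≤s n<c) = shift-< c f n<c

shift-+ : ∀ c f m → shift c f (c + m) ≡ f m
shift-+ zero    f m = refl
shift-+ (suc c) f m = shift-+ c f m

shift-shift : ∀ c d f n → shift c (shift d f) n ≡ shift (c + d) f n
shift-shift zero    d f n       = refl
shift-shift (suc c) d f zero    = refl
shift-shift (suc c) d f (suc n) = shift-shift c d f n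

shift-comm : ∀ c d f n → shift c (shift d f) n ≡ shift d (shift c f) n
shift-comm c d f n = begin
  shift c (shift d f) n  ≡⟨ shift-shift c d f n ⟩
  shift (c + d) f n      ≡⟨ cong (λ e → shift e f n) (+-comm c d) ⟩
  shift (d + c) f n      ≡⟨ shift-shift d c f n ⟨
  shift d (shift c f) n  ∎

shift-distrib-+ : ∀ c f g n → shift c (λ m → f m + g m) n ≡ shift c f n + shift c g n
shift-distrib-+ zero    f g n       = refl
shift-distrib-+ (suc c) f g zero    = refl
shift-distrib-+ (suc c) f g (suc n) = shift-distrib-+ c f g n

shift-cong-≤ : ∀ c {f g n} → (∀ m → m ≤ n → f m ≡ g m) → shift c f n ≡ shift c g n
shift-cong-≤ zero    {n = n}     f≗g = f≗g n ≤-refl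
shift-cong-≤ (suc c) {n = zero}  f≗g = refl
shift-cong-≤ (suc c) {n = suc n} f≗g = shift-cong-≤ c λ m m≤n → f≗g m (m≤n⇒m≤1+n m≤n)

shift-cong-< : ∀ c .{{_ : NonZero c}} {f g n} → (∀ m → m < n → f m ≡ g m) → shift c f n ≡ shift c g n
shift-cong-< (suc c) {n = zero}  f≗g = refl
shift-cong-< (suc c) {n = suc n} f≗g = shift-cong-≤ c λ m m≤n → f≗g m (s≤s m≤n)

shift-cong : ∀ c {f g} → (∀ m → f m ≡ g m) → ∀ n → shift c f n ≡ shift c g n
shift-cong c f≗g n = shift-cong-≤ c λ m _ → f≗g m

withPart-unfold : ∀ c .{{_ : NonZero c}} g n → withPart c g n ≡ g n + shift c (withPart c g) n
withPart-unfold c g n with n <? c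
... | yes n<c = begin
  withPart c g n                       ≡⟨ withPart-< c g n<c ⟩
  g n                                  ≡⟨ +-identityʳ (g n) ⟨
  g n + 0                              ≡⟨ cong (g n +_) (shift-< c (withPart c g) n<c) ⟨
  g n + shift c (withPart c g) n       ∎
... | no n≮c with (m , refl) ← m≤n⇒∃[o]m+o≡n (≮⇒≥ n≮c) = begin
  withPart c g (c + m)                           ≡⟨ withPart-+ c g m ⟩
  g (c + m) + withPart c g m                     ≡⟨ cong (g (c + m) +_) (shift-+ c (withPart c g) m) ⟨
  g (c + m) + shift c (withPart c g) (c + m)     ∎

-- 1/((1 − q^c)(1 − q^d)) = 1 + q^d/(1 − q^d) + q^c/(1 − q^c) + q^{c+d}/((1 − q^c)(1 − q^d)),
-- read off coefficientwise; the hypothesis lets the factors be reordered at arguments below n.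
withPart²-expand : ∀ c d .{{_ : NonZero c}} .{{_ : NonZero d}} g {n} →
  (∀ {m} → m < n → withPart c (withPart d g) m ≡ withPart d (withPart c g) m) →
  withPart c (withPart d g) n ≡
    (g n + shift d (withPart d g) n) + (shift c (withPart c g) n + shift c (shift d (withPart d (withPart c g))) n)
withPart²-expand c d g {n} agree = begin
  withPart c (withPart d g) n
    ≡⟨ withPart-unfold c (withPart d g) n ⟩
  withPart d g n + shift c (withPart c (withPart d g)) n
    ≡⟨ cong (withPart d g n +_) (shift-cong-< c λ m m<n → agree m<n) ⟩
  withPart d g n + shift c (withPart d (withPart c g)) n
    ≡⟨ cong₂ _+_ (withPart-unfold d g n) (shift-cong c (withPart-unfold d (withPart c g)) n) ⟩
  (g n + shift d (withPart d g) n) + shift c (λ m → withPart c g m + shift d (withPart d (withPart c g)) m) n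
    ≡⟨ cong (g n + shift d (withPart d g) n +_) (shift-distrib-+ c (withPart c g) _ n) ⟩
  (g n + shift d (withPart d g) n) + (shift c (withPart c g) n + shift c (shift d (withPart d (withPart c g))) n)
    ∎

withPart-comm : ∀ c d .{{_ : NonZero c}} .{{_ : NonZero d}} g n →
                withPart c (withPart d g) n ≡ withPart d (withPart c g) n
withPart-comm c d g = <-rec _ λ n agree → begin
  withPart c (withPart d g) n
    ≡⟨ withPart²-expand c d g agree ⟩
  (g n + shift d Wd n) + (shift c Wc n + shift c (shift d Wdc) n)
    ≡⟨ interchange (g n) _ _ _ ⟩
  (g n + shift c Wc n) + (shift d Wd n + shift c (shift d Wdc) n)
    ≡⟨ cong (λ x → g n + shift c Wc n + (shift d Wd n + x)) (shift-shift-cong agree) ⟩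
  (g n + shift c Wc n) + (shift d Wd n + shift d (shift c Wcd) n)
    ≡⟨ withPart²-expand d c g (λ m<n → sym (agree m<n)) ⟨
  withPart d (withPart c g) n
    ∎
  where
  Wc Wd Wcd Wdc : ℕ → ℕ
  Wc = withPart c g
  Wd = withPart d g
  Wcd = withPart c (withPart d g)
  Wdc = withPart d (withPart c g)
  shift-shift-cong : ∀ {n} → (∀ {m} → m < n → Wcd m ≡ Wdc m) → shift c (shift d Wdc) n ≡ shift d (shift c Wcd) n
  shift-shift-cong agree = trans
    (shift-cong-< c λ m m<n → shift-cong-< d λ k k<m → sym (agree (<-trans k<m m<n)))
    (shift-comm c d Wcd _)

%-+-cong : ∀ {M} .{{_ : NonZero M}} {x x' y y'} → x % M ≡ x' % M → y % M ≡ y' % M → (x + y) % M ≡ (x' + y') % M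
%-+-cong {M} {x} {x'} {y} {y'} x≡x' y≡y' = begin
  (x + y) % M                ≡⟨ %-distribˡ-+ x y M ⟩
  (x % M + y % M) % M        ≡⟨ cong₂ (λ u v → (u + v) % M) x≡x' y≡y' ⟩
  (x' % M + y' % M) % M      ≡⟨ %-distribˡ-+ x' y' M ⟨
  (x' + y') % M              ∎

%-+-cancelʳ : ∀ {M} .{{_ : NonZero M}} {x x'} y → (x + y) % M ≡ (x' + y) % M → x % M ≡ x' % M
%-+-cancelʳ {M@(suc M-1)} {x} {x'} y eq = begin
  x % M                       ≡⟨ [m+kn]%n≡m%n x y M ⟨
  (x + y * M) % M             ≡⟨ cong (_% M) (complete x) ⟩
  (x + y + y * M-1) % M       ≡⟨ %-+-cong {x = x + y} {x' + y} eq refl ⟩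
  (x' + y + y * M-1) % M      ≡⟨ cong (_% M) (complete x') ⟨
  (x' + y * M) % M            ≡⟨ [m+kn]%n≡m%n x' y M ⟩
  x' % M                      ∎
  where
  complete : ∀ z → z + y * M ≡ z + y + y * M-1
  complete z = trans (cong (z +_) (*-suc y M-1)) (sym (+-assoc z y (y * M-1)))

-- partitionsAtMost 0 is δ₀, so withPart c of it is the indicator function of cℕ.
withPart-δ : ∀ c .{{_ : NonZero c}} q {r} → r < c → withPart c (partitionsAtMost 0) (q * c + r) ≡ partitionsAtMost 0 r
withPart-δ c         zero    r<c = withPart-< c (partitionsAtMost 0) r<c
withPart-δ c@(suc _) (suc q) {r} r<c = begin
  withPart c δ (c + q * c + r)       ≡⟨ cong (withPart c δ) (+-assoc c (q * c) r) ⟩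
  withPart c δ (c + (q * c + r))     ≡⟨ withPart-+ c δ (q * c + r) ⟩
  withPart c δ (q * c + r)           ≡⟨ withPart-δ c q r<c ⟩
  δ r                                ∎
  where
  δ : ℕ → ℕ
  δ = partitionsAtMost 0

module _ (M : ℕ) .{{_ : NonZero M}} (π : ℕ) where

  EventuallyPeriodic : (ℕ → ℕ) → Set
  EventuallyPeriodic f = ∃[ s ] ∀ n → s ≤ n → f (n + π) % M ≡ f n % M

  eventuallyPeriodic-withPart⁻¹ : ∀ c .{{_ : NonZero c}} g → EventuallyPeriodic (withPart c g) → EventuallyPeriodic g
  eventuallyPeriodic-withPart⁻¹ c g (s , periodic) = c + s , λ n c+s≤n → shifted n c+s≤n
    where
    W : ℕ → ℕ
    W = withPart c g
    periodic-after-c : ∀ m → s ≤ m → g (c + (m + π)) % M ≡ g (c + m) % M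
    periodic-after-c m s≤m = %-+-cancelʳ (W (m + π)) (begin
      (g (c + (m + π)) + W (m + π)) % M   ≡⟨ cong (_% M) (withPart-+ c g (m + π)) ⟨
      W (c + (m + π)) % M                 ≡⟨ cong (λ z → W z % M) (+-assoc c m π) ⟨
      W (c + m + π) % M                   ≡⟨ periodic (c + m) (≤-trans s≤m (m≤n+m m c)) ⟩
      W (c + m) % M                       ≡⟨ cong (_% M) (withPart-+ c g m) ⟩
      (g (c + m) + W m) % M               ≡⟨ %-+-cong {x = g (c + m)} refl (periodic m s≤m) ⟨
      (g (c + m) + W (m + π)) % M         ∎)
    shifted : ∀ n → c + s ≤ n → g (n + π) % M ≡ g n % M
    shifted n c+s≤n with (k , refl) ← m≤n⇒∃[o]m+o≡n c+s≤n
      rewrite +-assoc c s k | +-assoc c (s + k) π = periodic-after-c (s + k) (m≤m+n s k)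

  eventuallyPeriodic-cong : ∀ {f g} → (∀ n → f n ≡ g n) → EventuallyPeriodic f → EventuallyPeriodic g
  eventuallyPeriodic-cong {f} {g} f≗g (s , periodic) = s , λ n s≤n → begin
    g (n + π) % M   ≡⟨ cong (_% M) (f≗g (n + π)) ⟨
    f (n + π) % M   ≡⟨ periodic n s≤n ⟩
    f n % M         ≡⟨ cong (_% M) (f≗g n) ⟩
    g n % M         ∎

  module _ (1<M : 1 < M) where

    eventuallyPeriodic-withPart-δ⇒∣ : ∀ c .{{_ : NonZero c}} → EventuallyPeriodic (withPart c (partitionsAtMost 0)) → c ∣ π
    eventuallyPeriodic-withPart-δ⇒∣ c (s , periodic) = m%n≡0⇒n∣m π c (δ%M≡1⇒≡0 (π % c) δ[π%c]≡1)
      where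
      δ W : ℕ → ℕ
      δ = partitionsAtMost 0
      W = withPart c δ
      δ%M≡1⇒≡0 : ∀ r → δ r % M ≡ 1 % M → r ≡ 0
      δ%M≡1⇒≡0 zero    _   = refl
      δ%M≡1⇒≡0 (suc r) 0≡1 = contradiction
        (trans (sym (m<n⇒m%n≡m (<-trans z<s 1<M))) (trans 0≡1 (m<n⇒m%n≡m 1<M))) 0≢1+n
      rearrange : ∀ s q r c → (s + q) * c + r ≡ s * c + (r + q * c)
      rearrange = solve-∀
      δ[π%c]≡1 : δ (π % c) % M ≡ 1 % M
      δ[π%c]≡1 = begin
        δ (π % c) % M                        ≡⟨ cong (_% M) (withPart-δ c (s + π / c) (m%n<n π c)) ⟨
        W ((s + π / c) * c + π % c) % M      ≡⟨ cong (λ z → W z % M) (rearrange s (π / c) (π % c) c) ⟩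
        W (s * c + (π % c + π / c * c)) % M  ≡⟨ cong (λ z → W (s * c + z) % M) (m≡m%n+[m/n]*n π c) ⟨
        W (s * c + π) % M                    ≡⟨ periodic (s * c) (m≤m*n s c) ⟩
        W (s * c) % M                        ≡⟨ cong (λ z → W z % M) (+-identityʳ (s * c)) ⟨
        W (s * c + 0) % M                    ≡⟨ cong (_% M) (withPart-δ c s (>-nonZero⁻¹ c)) ⟩
        1 % M                                ∎

    eventuallyPeriodic-withPart⇒∣ : ∀ c .{{_ : NonZero c}} j →
      EventuallyPeriodic (withPart c (partitionsAtMost j)) → c ∣ π
    eventuallyPeriodic-withPart⇒∣ c zero    periodic = eventuallyPeriodic-withPart-δ⇒∣ c periodic
    eventuallyPeriodic-withPart⇒∣ c (suc j) periodic =
      eventuallyPeriodic-withPart⇒∣ c j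
        (eventuallyPeriodic-withPart⁻¹ (suc j) (withPart c (partitionsAtMost j))
          (eventuallyPeriodic-cong (withPart-comm c (suc j) (partitionsAtMost j)) periodic))

    eventuallyPeriodic-partitionsAtMost⇒∣ : ∀ k → EventuallyPeriodic (partitionsAtMost k) → ∀ i → i < k → suc i ∣ π
    eventuallyPeriodic-partitionsAtMost⇒∣ (suc k) periodic i i<1+k with m<1+n⇒m<n∨m≡n i<1+k
    ... | inj₁ i<k  = eventuallyPeriodic-partitionsAtMost⇒∣ k
                        (eventuallyPeriodic-withPart⁻¹ (suc k) (partitionsAtMost k) periodic) i i<k
    ... | inj₂ refl = eventuallyPeriodic-withPart⇒∣ (suc i) i periodic

lcmUpTo-least : ∀ {m} k → (∀ i → i < k → suc i ∣ m) → lcmUpTo k ∣ m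
lcmUpTo-least zero    _     = 1∣ _
lcmUpTo-least (suc k) i+1∣m = lcm-least (lcmUpTo-least k λ i i<k → i+1∣m i (m<n⇒m<1+n i<k)) (i+1∣m k ≤-refl)

lemma2p4 : (p e k : ℕ) → Prime p → 1 ≤ e → 1 ≤ k → .{{_ : NonZero (p ^ e)}} → (π : ℕ) → IsMinimalPeriod (p ^ e) k π → lcmUpTo k ∣ π
lemma2p4 p e k p-prime 1≤e _ π ((_ , periodic) , _) =
  lcmUpTo-least k (eventuallyPeriodic-partitionsAtMost⇒∣ (p ^ e) π 1<p^e k (0 , λ n _ → periodic n))
  where
  1<p^e : 1 < p ^ e
  1<p^e = ^-monoʳ-< p (nonTrivial⇒n>1 p {{prime⇒nonTrivial p-prime}}) 1≤e
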